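{- Let $\bigl(A, (\mathbb{U}_a,\mathcal{U}_a)_{a\in A}, (\Omega,\mathcal{F}), (\mathcal{I}_a)_{a\in A}\bigr)$ be a W-model, let $H\subset\mathbb{H}$ be a subset of configurations and let $W\subset A$ be a subset of agents. Then the conditional parental relations satisfy $$\mathcal{P}_{W,H} = \Delta_{A\setminus W}\,\mathcal{P}_{\emptyset,H},$$ that is, for every agent $a\in A$ one has $\mathcal{P}_{W,H}\,a = (A\setminus W)\cap \mathcal{P}_{\emptyset,H}\,a$.
   Context: A W-model consists of: a finite set $A$ (agents); for each $a\in A$ a set $\mathbb{U}_a$ (decisions of $a$) with a $\sigma$-field $\mathcal{U}_a$; a set $\Omega$ (states of Nature) with a $\sigma$-field $\mathcal{F}$; and for each $a\in A$ a $\sigma$-field $\mathcal{I}_a\subset\mathcal{H}$ (the information field of $a$), where the configuration space is $\mathbb{H}=\Omega\times\prod_{a\in A}\mathbb{U}_a$ with configuration field $\mathcal{H}=\mathcal{F}\otimes\bigotimes_{a\in A}\mathcal{U}_a$. For $B\subset A$, set $\mathcal{H}_B=\mathcal{F}\otimes\bigotimes_{b\in B}\mathcal{U}_b\otimes\bigotimes_{c\notin B}\{\emptyset,\mathbb{U}_c\}\subset\mathcal{H}$. For a $\sigma$-field $\mathcal{G}$ on $\mathbb{H}$ and $H\subset\mathbb{H}$, $\mathcal{G}\cap H=\{G\cap H: G\in\mathcal{G}\}$ denotes the trace field on $H$. For $H\subset\mathbb{H}$ and $W\subset A$, define for each $a\in A$ $$\mathcal{P}_{W,H}\,a=\bigcap\{B\subset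 A:\ \mathcal{I}_a\cap H\subset \mathcal{H}_{B\cup W}\cap H\},$$ and the binary relation $\mathcal{P}_{W,H}$ on $A$ by $b\,\mathcal{P}_{W,H}\,a \iff b\in\mathcal{P}_{W,H}\,a$. For $B\subset A$, $\Delta_B=\{(a,a): a\in B\}$. The composition of relations $R,R'$ on $A$ is defined by $a\,(RR')\,b\iff\exists \delta\in A$ with $a\,R\,\delta$ and $\delta\,R'\,b$; for a relation $R$ and $b\in A$, $R\,b=\{a\in A: a\,R\,b\}$. -}

module Defs where

open import Level using (Level; 0ℓ) renaming (suc to lsuc)
open import Data.Nat using (ℕ)
open import Data.Fin using (Fin)
open import Data.Fin.Subset using (Subset; _∈_; _∉_; _∪_; ⊥; ⊤)
open import Data.Product using (Σ; _×_; _,_; ∃)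
open import Data.Sum using (_⊎_)
open import Relation.Binary.PropositionalEquality using (_≡_)
open import Data.Empty renaming (⊥ to Empty)
open import Data.Unit using () renaming (⊤ to Unit)
open import Data.Product using (proj₁; proj₂)
open import Level using (Lift)

SubsetOf : Set → Set₁
SubsetOf X = X → Set

Family : Set → Set₂
Family X = SubsetOf X → Set₁

∅ˢ : {X : Set} → SubsetOf X
∅ˢ _ = Empty

fullˢ : {X : Set} → SubsetOf X
fullˢ _ = Unit

∁ˢ : {X : Set} → SubsetOf X → SubsetOf X
∁ˢ S x = S x → Empty

⋃ˢ : {X : Set} → (ℕ → SubsetOf X) → SubsetOf X
⋃ˢ f x = Σ ℕ (λ i → f i x)

_∩ˢ_ : {X : Set} → SubsetOf X → SubsetOf X → SubsetOf X
(S ∩ˢ T) x = S x × T x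

_≐_ : {X : Set} → SubsetOf X → SubsetOf X → Set
S ≐ T = ∀ x → (S x → T x) × (T x → S x)

_⊆ᶠ_ : {X : Set} → Family X → Family X → Set₁
𝒢 ⊆ᶠ 𝒢' = ∀ S → 𝒢 S → 𝒢' S

record IsSigmaField {X : Set} (𝒢 : Family X) : Set₁ where
  field
    ∅-mem : 𝒢 ∅ˢ
    ∁-mem : ∀ S → 𝒢 S → 𝒢 (∁ˢ S)
    ⋃-mem : (f : ℕ → SubsetOf X) → (∀ i → 𝒢 (f i)) → 𝒢 (⋃ˢ f)
    ≐-mem : ∀ S T → S ≐ T → 𝒢 S → 𝒢 (T)

data σGen {X : Set} (𝒢 : Family X) : Family X where
  gen   : ∀ {S} → 𝒢 S → σGen 𝒢 S
  empty : σGen 𝒢 ∅ˢ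
  compl : ∀ {S} → σGen 𝒢 S → σGen 𝒢 (∁ˢ S)
  union : (f : ℕ → SubsetOf X) → (∀ i → σGen 𝒢 (f i)) → σGen 𝒢 (⋃ˢ f)
  ext   : ∀ {S T} → S ≐ T → σGen 𝒢 S → σGen 𝒢 T

trivialField : {X : Set} → Family X
trivialField S = Lift (lsuc 0ℓ) ((S ≐ ∅ˢ) ⊎ (S ≐ fullˢ))

Config : {n : ℕ} → Set → (Fin n → Set) → Set
Config {n} Ω U = Ω × ((a : Fin n) → U a)

RectB : {n : ℕ} {Ω : Set} {U : Fin n → Set} →
        Family Ω → ((a : Fin n) → Family (U a)) → Subset n →
        Family (Config Ω U)
RectB {n} {Ω} {U} ℱ 𝒰 B S =
  Σ (SubsetOf Ω) λ F → Σ ((a : Fin n) → SubsetOf (U a)) λ G →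
    ℱ F × ((a : Fin n) → (a ∈ B → 𝒰 a (G a)) × (a ∉ B → trivialField (G a)))
    × Lift (lsuc 0ℓ) (S ≐ (λ h → F (proj₁ h) × ((a : Fin n) → G a (proj₂ h a))))

-- ℋ_B = ℱ ⊗ ⨂_{b∈B} 𝒰_b ⊗ ⨂_{c∉B} {∅, 𝕌_c}  (product σ-field,
-- generated by the measurable rectangles above)
ℋ : {n : ℕ} {Ω : Set} {U : Fin n → Set} →
    Family Ω → ((a : Fin n) → Family (U a)) → Subset n →
    Family (Config Ω U)
ℋ ℱ 𝒰 B = σGen (RectB ℱ 𝒰 B)

record WModel (n : ℕ) : Set₂ where
  field
    Ω    : Set
    ℱ    : Family Ω
    ℱ-σ  : IsSigmaField ℱ
    𝕌    : Fin n → Set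
    𝒰    : (a : Fin n) → Family (𝕌 a)
    𝒰-σ  : (a : Fin n) → IsSigmaField (𝒰 a)
    𝓘    : (a : Fin n) → Family (Config Ω 𝕌)
    𝓘-σ  : (a : Fin n) → IsSigmaField (𝓘 a)
    𝓘⊆ℋ : (a : Fin n) → 𝓘 a ⊆ᶠ ℋ ℱ 𝒰 ⊤

  ℍ : Set
  ℍ = Config Ω 𝕌

  ℋ[_] : Subset n → Family ℍ
  ℋ[ B ] = ℋ ℱ 𝒰 B

TraceSub : {X : Set} → SubsetOf X → Family X → Family X → Set₁
TraceSub H 𝒢 𝒢' =
  ∀ G → 𝒢 G → Σ _ λ G' → 𝒢' G' × Lift (lsuc 0ℓ) ((G ∩ˢ H) ≐ (G' ∩ˢ H))

AgentRel : ℕ → Set₂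
AgentRel n = Fin n → Fin n → Set₁

Δ : {n : ℕ} → Subset n → AgentRel n
Δ B a a' = Lift (lsuc 0ℓ) ((a ≡ a') × (a ∈ B))

_∘ʳ_ : {n : ℕ} → AgentRel n → AgentRel n → AgentRel n
(R ∘ʳ R') a b = Σ (Fin _) λ δ → R a δ × R' δ b

_≡ʳ_ : {n : ℕ} → AgentRel n → AgentRel n → Set₁
R ≡ʳ R' = ∀ a b → (R a b → R' a b) × (R' a b → R a b)

-- conditional parental relation:
-- 𝒫_{W,H} a = ⋂ {B ⊆ A : 𝓘_a ∩ H ⊂ ℋ_{B ∪ W} ∩ H},
-- b 𝒫_{W,H} a iff b ∈ 𝒫_{W,H} a
𝒫 : {n : ℕ} (M : WModel n) → Subset n → SubsetOf (WModel.ℍ M) → AgentRel n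
𝒫 {n} M W H b a =
  (B : Subset n) → TraceSub H (𝓘 a) ℋ[ B ∪ W ] → Lift (lsuc 0ℓ) (b ∈ B)
  where open WModel M

{-# OPTIONS --safe #-}
module Submission where

-- Call B admissible for W when 𝓘_a ∩ H ⊂ ℋ_{B ∪ W} ∩ H, so that 𝒫_{W,H} a is
-- the intersection of the admissible B; admissibility only depends on B ∪ W.
-- Taking B = A ∖ W (admissible since 𝓘_a ⊂ ℋ_A) shows 𝒫_{W,H} a ⊂ A ∖ W.
-- If B is admissible for W, then B ∪ W is admissible for ∅, so
-- 𝒫_{∅,H} a ⊂ B ∪ W; conversely ℋ_B ⊂ ℋ_{B ∪ W} makes every B admissible
-- for ∅ also admissible for W. Intersecting with A ∖ W gives the identity.

open import Defs
open import Data.Nat using (ℕ)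
open import Data.Fin using (Fin)
open import Data.Fin.Subset using (Subset; ∁; ⊥; _∈_; _∉_; _∪_; _⊆_)
open import Data.Fin.Subset.Properties
  using (_∈?_; ⊆-reflexive; ⊆-trans; p⊆p∪q; x∈p∪q⁻; x∈∁p⇒x∉p; ∪-identityʳ; ∪-inverseˡ)
open import Data.Product using (_,_; proj₁; proj₂)
open import Data.Sum using (inj₁; inj₂)
open import Data.Unit using (tt)
open import Data.Empty using (⊥-elim)
open import Function using (_∘_; id)
open import Level using (lift; lower)
open import Relation.Nullary using (yes; no)
open import Relation.Binary.PropositionalEquality using (refl; sym)

trivialField⊆σ-field : {X : Set} {𝒢 : Family X} → IsSigmaField 𝒢 → trivialField ⊆ᶠ 𝒢
trivialField⊆σ-field σ S (lift (inj₁ S≐∅)) =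
  ≐-mem ∅ˢ S (λ x → (λ ()) , proj₁ (S≐∅ x)) ∅-mem
  where open IsSigmaField σ
trivialField⊆σ-field σ S (lift (inj₂ S≐full)) =
  ≐-mem (∁ˢ ∅ˢ) S (λ x → (λ _ → proj₂ (S≐full x) tt) , (λ _ ())) (∁-mem ∅ˢ ∅-mem)
  where open IsSigmaField σ

σGen-mono : {X : Set} {𝒢 𝒢' : Family X} → 𝒢 ⊆ᶠ 𝒢' → σGen 𝒢 ⊆ᶠ σGen 𝒢'
σGen-mono 𝒢⊆𝒢' S (gen g)       = gen (𝒢⊆𝒢' S g)
σGen-mono 𝒢⊆𝒢' _ empty         = empty
σGen-mono 𝒢⊆𝒢' _ (compl g)     = compl (σGen-mono 𝒢⊆𝒢' _ g)
σGen-mono 𝒢⊆𝒢' _ (union f gs)  = union f (λ i → σGen-mono 𝒢⊆𝒢' (f i) (gs i))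
σGen-mono 𝒢⊆𝒢' _ (ext S≐T g)   = ext S≐T (σGen-mono 𝒢⊆𝒢' _ g)

⊆ᶠ⇒TraceSub : {X : Set} {H : SubsetOf X} {𝒢 𝒢' : Family X} → 𝒢 ⊆ᶠ 𝒢' → TraceSub H 𝒢 𝒢'
⊆ᶠ⇒TraceSub 𝒢⊆𝒢' G g = G , 𝒢⊆𝒢' G g , lift (λ _ → id , id)

TraceSub-monoʳ : {X : Set} {H : SubsetOf X} {𝒢 𝒢' 𝒢'' : Family X} →
                 𝒢' ⊆ᶠ 𝒢'' → TraceSub H 𝒢 𝒢' → TraceSub H 𝒢 𝒢''
TraceSub-monoʳ 𝒢'⊆𝒢'' t G g with t G g
... | G' , g' , G∩H≐G'∩H = G' , 𝒢'⊆𝒢'' G' g' , G∩H≐G'∩H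

RectB-mono : {n : ℕ} {Ω : Set} {U : Fin n → Set}
             {ℱ : Family Ω} {𝒰 : (a : Fin n) → Family (U a)} → (∀ a → IsSigmaField (𝒰 a)) →
             {B B' : Subset n} → B ⊆ B' → RectB ℱ 𝒰 B ⊆ᶠ RectB ℱ 𝒰 B'
RectB-mono {𝒰 = 𝒰} 𝒰-σ {B} {B'} B⊆B' S (F , G , F∈ℱ , G-mem , S≐F×G) =
  F , G , F∈ℱ , (λ a → G∈𝒰 a , proj₂ (G-mem a) ∘ (_∘ B⊆B')) , S≐F×G
  where
  G∈𝒰 : ∀ a → a ∈ B' → 𝒰 a (G a)
  G∈𝒰 a _ with a ∈? B
  ... | yes a∈B = proj₁ (G-mem a) a∈B
  ... | no a∉B  = trivialField⊆σ-field (𝒰-σ a) (G a) (proj₂ (G-mem a) a∉B)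

module _ {n : ℕ} (M : WModel n) (H : SubsetOf (WModel.ℍ M)) where
  open WModel M

  TraceSub-ℋ-mono : ∀ {a} {B B' : Subset n} →
                    B ⊆ B' → TraceSub H (𝓘 a) ℋ[ B ] → TraceSub H (𝓘 a) ℋ[ B' ]
  TraceSub-ℋ-mono B⊆B' = TraceSub-monoʳ (σGen-mono (RectB-mono 𝒰-σ B⊆B'))

  𝒫⇒∈∁ : ∀ {W b a} → 𝒫 M W H b a → b ∈ ∁ W
  𝒫⇒∈∁ {W} {a = a} b𝒫a =
    lower (b𝒫a (∁ W) (TraceSub-ℋ-mono (⊆-reflexive (sym (∪-inverseˡ W))) (⊆ᶠ⇒TraceSub (𝓘⊆ℋ a))))

  𝒫⇒𝒫⊥ : ∀ {W b a} → 𝒫 M W H b a → 𝒫 M ⊥ H b a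
  𝒫⇒𝒫⊥ {W} b𝒫a B t =
    b𝒫a B (TraceSub-ℋ-mono (⊆-trans (⊆-reflexive (∪-identityʳ B)) (p⊆p∪q W)) t)

  𝒫⊥⇒𝒫 : ∀ {W b a} → b ∉ W → 𝒫 M ⊥ H b a → 𝒫 M W H b a
  𝒫⊥⇒𝒫 {W} b∉W b𝒫⊥a B t
    with x∈p∪q⁻ B W (lower (b𝒫⊥a (B ∪ W) (TraceSub-ℋ-mono (p⊆p∪q ⊥) t)))
  ... | inj₁ b∈B = lift b∈B
  ... | inj₂ b∈W = ⊥-elim (b∉W b∈W)

proposition1 : {n : ℕ} (M : WModel n) (H : SubsetOf (WModel.ℍ M)) (W : Subset n) →
    𝒫 M W H ≡ʳ (Δ (∁ W) ∘ʳ 𝒫 M ⊥ H)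
proposition1 M H W b a = to , from
  where
  to : 𝒫 M W H b a → (Δ (∁ W) ∘ʳ 𝒫 M ⊥ H) b a
  to b𝒫a = b , lift (refl , 𝒫⇒∈∁ M H b𝒫a) , 𝒫⇒𝒫⊥ M H b𝒫a

  from : (Δ (∁ W) ∘ʳ 𝒫 M ⊥ H) b a → 𝒫 M W H b a
  from (_ , lift (refl , b∈∁W) , b𝒫⊥a) = 𝒫⊥⇒𝒫 M H (x∈∁p⇒x∉p b∈∁W) b𝒫⊥a
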